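{- Let $G$ be a graph with a spanning forest $F$ and let $X\subseteq V(G)$ with $e_G(X,F)=0$. Let $h$ be a nonnegative integer-valued function on $X$. Then $G$ has a spanning tree $T$ containing $F$ such that $d_T(v)\le h(v)+d_F(v)$ for each $v\in X$ if and only if for all $S\subseteq X$, $$\omega(G\setminus[S,F])\le\sum_{v\in S}h(v)+1.$$
   Context: All graphs are finite, without loops, multiple edges allowed. $\omega(H)$ is the number of components of $H$. For $S\subseteq V(G)$, $G\setminus[S,F]$ is obtained from $G$ by removing all edges incident to vertices of $S$ except the edges of $F$ (no vertices are removed). $e_G(S,F)$ is the number of edges of $G$ with both ends in $S$ joining different components of $F$. -}

module Defs where

open import Data.Nat using (ℕ; zero; suc; _+_; _≤_)
open import Data.Bool using (Bool; true; false; if_then_else_; _∧_; _∨_; not)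
open import Data.Fin using (Fin)
open import Data.Fin.Subset using (Subset; _∈_)
open import Data.Fin.Subset using () renaming (∣_∣ to card)
open import Data.Vec using (Vec; lookup; tabulate)
open import Data.List using (List; []; _∷_; map; allFin)
open import Data.Nat.ListAction using (sum)
open import Data.List.Relation.Unary.Unique.Propositional using (Unique)
open import Data.Product using (Σ; _×_; _,_; proj₁; proj₂)
open import Data.Sum using (_⊎_)
open import Relation.Binary.PropositionalEquality using (_≡_; _≢_)
open import Relation.Nullary using (¬_; does)
open import Function using (Surjective)
open import Function.Bundles using (_⇔_)
import Data.Fin as F

-- A finite loopless multigraph: vertices Fin n, edges Fin m,
-- edge e has (unordered) endpoints ends e; parallel edges allowed.
record Graph : Set where
  field
    n        : ℕ
    m        : ℕ
    ends     : Fin m → Fin n × Fin n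
    loopless : ∀ e → proj₁ (ends e) ≢ proj₂ (ends e)
open Graph public

-- Spanning subgraphs of G are given by their edge sets (Subset (m G)).
EdgeSet : Graph → Set
EdgeSet G = Subset (m G)

VSet : Graph → Set
VSet G = Subset (n G)

Joins : (G : Graph) → Fin (m G) → Fin (n G) → Fin (n G) → Set
Joins G e u w = (proj₁ (ends G e) ≡ u × proj₂ (ends G e) ≡ w)
              ⊎ (proj₁ (ends G e) ≡ w × proj₂ (ends G e) ≡ u)

data Walk (G : Graph) (E : EdgeSet G) : Fin (n G) → Fin (n G) → Set where
  nil  : ∀ {u} → Walk G E u u
  cons : ∀ {u w v} (e : Fin (m G)) → e ∈ E → Joins G e u w → Walk G E w v → Walk G E u v

walkEdges : ∀ {G E u v} → Walk G E u v → List (Fin (m G))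
walkEdges nil = []
walkEdges (cons e _ _ p) = e ∷ walkEdges p

walkStarts : ∀ {G E u v} → Walk G E u v → List (Fin (n G))
walkStarts nil = []
walkStarts (cons {u = u} _ _ _ p) = u ∷ walkStarts p

isNil : ∀ {G E u v} → Walk G E u v → Bool
isNil nil = true
isNil (cons _ _ _ _) = false

Connected : (G : Graph) → EdgeSet G → Fin (n G) → Fin (n G) → Set
Connected G E u v = Walk G E u v

Cycle : (G : Graph) → EdgeSet G → Set
Cycle G E = Σ (Fin (n G)) λ v → Σ (Walk G E v v) λ c →
  (isNil c ≡ false) × Unique (walkEdges c) × Unique (walkStarts c)

IsForest : (G : Graph) → EdgeSet G → Set
IsForest G E = ¬ Cycle G E

IsSpanningTree : (G : Graph) → EdgeSet G → Set
IsSpanningTree G T = IsForest G T × (∀ u v → Connected G T u v)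

-- ω(H) = k : the components of the spanning subgraph H (edge set E) are
-- indexed by Fin k: a surjective labelling whose fibres are exactly the
-- connectivity classes.
HasComponents : (G : Graph) → EdgeSet G → ℕ → Set
HasComponents G E k = Σ (Fin (n G) → Fin k) λ c →
  Surjective _≡_ _≡_ c × (∀ u v → (c u ≡ c v) ⇔ Connected G E u v)

SubE : (G : Graph) → EdgeSet G → EdgeSet G → Set
SubE G A B = ∀ {e : Fin (m G)} → e ∈ A → e ∈ B

incident : (G : Graph) → Fin (n G) → EdgeSet G
incident G v = tabulate λ e → does (proj₁ (ends G e) F.≟ v) ∨ does (proj₂ (ends G e) F.≟ v)

deg : (G : Graph) → EdgeSet G → Fin (n G) → ℕ
deg G E v = card (tabulate λ e → lookup E e ∧ lookup (incident G v) e)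

-- G ∖ [S, F]: delete all edges incident with S except those of F
removeExcept : (G : Graph) → VSet G → EdgeSet G → EdgeSet G
removeExcept G S F = tabulate λ e →
  (not (lookup S (proj₁ (ends G e))) ∧ not (lookup S (proj₂ (ends G e)))) ∨ lookup F e

-- e_G(X,F) = 0 : no edge of G with both ends in X joins different
-- components of F.
eZero : (G : Graph) → VSet G → EdgeSet G → Set
eZero G X F = ∀ e → proj₁ (ends G e) ∈ X → proj₂ (ends G e) ∈ X →
  Connected G F (proj₁ (ends G e)) (proj₂ (ends G e))

sumOver : (G : Graph) → VSet G → (Fin (n G) → ℕ) → ℕ
sumOver G S h = sum (map (λ v → if lookup S v then h v else 0) (allFin (n G)))

SubV : (G : Graph) → VSet G → VSet G → Set
SubV G A B = ∀ {v : Fin (n G)} → v ∈ A → v ∈ B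

module Submission where

-- Necessity: G ∖ [S,F] contains T minus its non-forest edges at S, at
-- most h(S) edges, and each deleted edge adds at most one component.
-- Sufficiency: call A ⊇ F feasible if the condition holds with A for
-- E(G).  While some v ∈ X has more than h(v) non-forest edges in A, one
-- of them can be deleted keeping A feasible: otherwise each such edge is
-- a bridge of A ∖ [S_e,F] for a tight S_e ⊆ X avoiding v; tight sets are
-- closed under union (ω is submodular, h modular, e_G(X,F) = 0), and
-- deleting all these bridges from A ∖ [⋃ S_e, F] violates feasibility
-- at ⋃ S_e ∪ {v}.  Without such v, any spanning forest of the connected
-- A through F is the tree.

open import Defs
open import Data.Nat using (ℕ; zero; suc; _+_; _≤_; _<_; _<?_; z≤n; s≤s)
open import Data.Nat.Properties using (≤-trans; ≤-reflexive; ≤-antisym; ≤-pred; <-≤-trans; <⇒≱; ≮⇒≥; +-comm; +-suc; +-identityʳ; +-mono-≤; +-monoˡ-≤; +-monoʳ-≤; +-cancelʳ-≤; +-cancelˡ-≤; m≤m+n; n≤1+n; module ≤-Reasoning)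
open import Data.Nat.Tactic.RingSolver using (solve-∀)
open import Data.Nat.ListAction using (sum)
open import Data.Bool using (Bool; true; false; not; _∧_; _∨_; if_then_else_)
open import Data.Bool.Properties using (∨-zeroʳ)
open import Data.Fin using (Fin; zero; suc; _≟_; punchIn; punchOut)
open import Data.Fin.Properties using (any?; punchOut-injective; punchOut-punchIn; punchOut-cong; punchInᵢ≢i; injective⇒≤)
open import Data.Fin.Subset using (Subset; _∈_; _∉_; _⊆_; _⊂_; _⊃_; _∪_; _∩_; _─_; _-_; ⁅_⁆; ⋃; ⊥; ⊤; ∣_∣; outside; inside)
open import Data.Fin.Subset.Properties using (_∈?_; _⊆?_; anySubset?; nonempty?; Empty-unique; ∉⊥; ∈⊤; x∈p∪q⁺; x∈p∪q⁻; x∈p∩q⁺; x∈p∩q⁻; x∈⁅x⁆; x∈⁅y⁆⇒x≡y; x∈p∧x≢y⇒x∈p-y; x∈p∧x∉q⇒x∈p─q; p⊆p∪q; q⊆p∪q; p∩q⊆p; p─q⊆p; ⊆-antisym; ∪-assoc; ∪-comm; ∩-comm; ∪-identityʳ; ∪-abs-∩; p─⊥≡p; x∈p⇒p-x⊂p; ∣⊥∣≡0; ∣⁅x⁆∣≡1; p⊆q⇒∣p∣≤∣q∣; x∈p⇒∣p-x∣<∣p∣)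
open import Data.Fin.Subset.Induction using (⊂-wellFounded; ⊃-wellFounded; Acc; acc)
open import Data.Vec using ([]; _∷_; here; there; tabulate; lookup)
open import Data.Vec.Properties using (lookup∘tabulate; []=⇒lookup; lookup⇒[]=; lookup-zipWith; tabulate-cong; tabulate∘lookup)
open import Data.List using (List; []; _∷_; map; allFin)
open import Data.List.Properties using (map-tabulate; map-∘)
open import Data.List.Membership.Propositional using () renaming (_∈_ to _∈ₗ_; _∉_ to _∉ₗ_)
open import Data.List.Membership.Propositional.Properties using (∈-map⁺; ∈-allFin)
open import Data.List.Relation.Unary.Any using (here; there) renaming (any? to anyₗ?)
open import Data.List.Relation.Unary.All using () renaming (lookup to lookupᴬ)
open import Data.List.Relation.Unary.All.Properties using (All¬⇒¬Any)
open import Data.List.Relation.Unary.AllPairs using (_∷_)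
open import Data.List.Relation.Unary.Unique.Propositional using (Unique)
open import Data.Product using (Σ; ∃; _×_; _,_; proj₁; proj₂)
open import Data.Sum using (_⊎_; inj₁; inj₂; [_,_])
open import Data.Empty using (⊥-elim)
open import Function using (_∘_)
open import Function.Bundles using (_⇔_; Equivalence; mk⇔)
open import Relation.Binary.PropositionalEquality using (_≡_; _≢_; refl; sym; trans; cong; cong₂; subst; module ≡-Reasoning)
open import Relation.Nullary using (¬_; Dec; yes; no; does)
open import Relation.Nullary.Decidable using (_×-dec_; ¬?)

x∈p─q⇒x∉q : ∀ {n x} (p q : Subset n) → x ∈ p ─ q → x ∉ q
x∈p─q⇒x∉q (_ ∷ p) (inside ∷ q) (there x∈p─q) (there x∈q) = x∈p─q⇒x∉q p q x∈p─q x∈q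
x∈p─q⇒x∉q (_ ∷ p) (outside ∷ q) (there x∈p─q) (there x∈q) = x∈p─q⇒x∉q p q x∈p─q x∈q

x∈p-y⇒x≢y : ∀ {n x} (p : Subset n) y → x ∈ p - y → x ≢ y
x∈p-y⇒x≢y p y x∈p-y refl = x∈p─q⇒x∉q p ⁅ y ⁆ x∈p-y (x∈⁅x⁆ y)

p─q⊆p-x : ∀ {n x} (p : Subset n) {q} → x ∈ q → p ─ q ⊆ p - x
p─q⊆p-x {x = x} p {q} x∈q {y} y∈ = x∈p∧x≢y⇒x∈p-y (p─q⊆p p q y∈) λ { refl → x∈p─q⇒x∉q p q y∈ x∈q }

∪-monoˡ-⊆ : ∀ {n} {p q : Subset n} r → p ⊆ q → p ∪ r ⊆ q ∪ r
∪-monoˡ-⊆ {p = p} r p⊆q x∈ with x∈p∪q⁻ p r x∈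
... | inj₁ x∈p = x∈p∪q⁺ (inj₁ (p⊆q x∈p))
... | inj₂ x∈r = x∈p∪q⁺ (inj₂ x∈r)

∉∩-cases : ∀ {n} {S S' : Subset n} {a b} → a ∉ S ∩ S' → b ∉ S ∩ S' →
  (a ∉ S × b ∉ S) ⊎ (a ∉ S' × b ∉ S') ⊎ (a ∈ S ∪ S' × b ∈ S ∪ S')
∉∩-cases {S = S} {S'} {a} {b} a∉ b∉ with a ∈? S | b ∈? S
... | no a∉S | no b∉S = inj₁ (a∉S , b∉S)
... | yes a∈S | yes b∈S = inj₂ (inj₁ ((λ a∈S' → a∉ (x∈p∩q⁺ (a∈S , a∈S'))) , (λ b∈S' → b∉ (x∈p∩q⁺ (b∈S , b∈S')))))
... | yes a∈S | no b∉S with b ∈? S'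
...   | yes b∈S' = inj₂ (inj₂ (x∈p∪q⁺ (inj₁ a∈S) , x∈p∪q⁺ (inj₂ b∈S')))
...   | no b∉S' = inj₂ (inj₁ ((λ a∈S' → a∉ (x∈p∩q⁺ (a∈S , a∈S'))) , b∉S'))
∉∩-cases {S = S} {S'} {a} {b} a∉ b∉ | no a∉S | yes b∈S with a ∈? S'
...   | yes a∈S' = inj₂ (inj₂ (x∈p∪q⁺ (inj₂ a∈S') , x∈p∪q⁺ (inj₁ b∈S)))
...   | no a∉S' = inj₂ (inj₁ (a∉S' , (λ b∈S' → b∉ (x∈p∩q⁺ (b∈S , b∈S')))))

∈-tabulate⁺ : ∀ {n} {f : Fin n → Bool} {x} → f x ≡ true → x ∈ tabulate f
∈-tabulate⁺ {f = f} {x} fx = lookup⇒[]= x _ (trans (lookup∘tabulate f x) fx)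

∈-tabulate⁻ : ∀ {n} {f : Fin n → Bool} {x} → x ∈ tabulate f → f x ≡ true
∈-tabulate⁻ {f = f} {x} x∈ = trans (sym (lookup∘tabulate f x)) ([]=⇒lookup x∈)

tabulate-∧ : ∀ {n} (p q : Subset n) → tabulate (λ i → lookup p i ∧ lookup q i) ≡ p ∩ q
tabulate-∧ p q = trans (tabulate-cong (λ i → sym (lookup-zipWith _∧_ i p q))) (tabulate∘lookup (p ∩ q))

∉⇒lookup≡false : ∀ {n x} (p : Subset n) → x ∉ p → lookup p x ≡ false
∉⇒lookup≡false {x = x} p x∉p with lookup p x in eq
... | true = ⊥-elim (x∉p (lookup⇒[]= x p eq))
... | false = refl

lookup≡false⇒∉ : ∀ {n x} (p : Subset n) → lookup p x ≡ false → x ∉ p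
lookup≡false⇒∉ p eq x∈p with () ← trans (sym ([]=⇒lookup x∈p)) eq

p⊆p-x∪⁅x⁆ : ∀ {n} (p : Subset n) x → p ⊆ (p - x) ∪ ⁅ x ⁆
p⊆p-x∪⁅x⁆ p x {y} y∈p with y ≟ x
... | yes refl = x∈p∪q⁺ (inj₂ (x∈⁅x⁆ x))
... | no y≢x = x∈p∪q⁺ (inj₁ (x∈p∧x≢y⇒x∈p-y y∈p y≢x))

p-x∪⁅x⁆≡p : ∀ {n x} {p : Subset n} → x ∈ p → (p - x) ∪ ⁅ x ⁆ ≡ p
p-x∪⁅x⁆≡p {x = x} {p} x∈p = ⊆-antisym ⊆p (p⊆p-x∪⁅x⁆ p x)
  where
  ⊆p : (p - x) ∪ ⁅ x ⁆ ⊆ p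
  ⊆p y∈ with x∈p∪q⁻ (p - x) ⁅ x ⁆ y∈
  ... | inj₁ y∈p-x = p─q⊆p p ⁅ x ⁆ y∈p-x
  ... | inj₂ y∈⁅x⁆ rewrite x∈⁅y⁆⇒x≡y x y∈⁅x⁆ = x∈p

∪-insert : ∀ {n x} (p : Subset n) {q} → x ∈ q → p ∪ q ≡ (p ∪ (q - x)) ∪ ⁅ x ⁆
∪-insert {x = x} p {q} x∈q = trans (cong (p ∪_) (sym (p-x∪⁅x⁆≡p x∈q))) (sym (∪-assoc p (q - x) ⁅ x ⁆))

─-insert : ∀ {n x} {p : Subset n} q → x ∈ p → p ─ (q - x) ≡ (p ─ q) ∪ ⁅ x ⁆
─-insert {x = x} {p} q x∈p = ⊆-antisym ⊆ins ins⊆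
  where
  ⊆ins : p ─ (q - x) ⊆ (p ─ q) ∪ ⁅ x ⁆
  ⊆ins {y} y∈ with y ≟ x
  ... | yes refl = x∈p∪q⁺ (inj₂ (x∈⁅x⁆ x))
  ... | no y≢x = x∈p∪q⁺ (inj₁ (x∈p∧x∉q⇒x∈p─q (p─q⊆p p (q - x) y∈)
                  (λ y∈q → x∈p─q⇒x∉q p (q - x) y∈ (x∈p∧x≢y⇒x∈p-y y∈q y≢x))))
  ins⊆ : (p ─ q) ∪ ⁅ x ⁆ ⊆ p ─ (q - x)
  ins⊆ y∈ with x∈p∪q⁻ (p ─ q) ⁅ x ⁆ y∈
  ... | inj₁ y∈p─q = x∈p∧x∉q⇒x∈p─q (p─q⊆p p q y∈p─q) (λ y∈q-x → x∈p─q⇒x∉q p q y∈p─q (p─q⊆p q ⁅ x ⁆ y∈q-x))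
  ... | inj₂ y∈⁅x⁆ rewrite x∈⁅y⁆⇒x≡y x y∈⁅x⁆ = x∈p∧x∉q⇒x∈p─q x∈p (λ x∈q-x → x∈p-y⇒x≢y q x x∈q-x refl)

subset-induction : ∀ {n ℓ} (P : Subset n → Set ℓ) → P ⊥ →
  (∀ {p x} → x ∈ p → P (p - x) → P p) → ∀ p → P p
subset-induction P base step p = go p (⊂-wellFounded p)
  where
  go : ∀ p → Acc _⊂_ p → P p
  go p (acc smaller) with nonempty? p
  ... | yes (x , x∈p) = step x∈p (go (p - x) (smaller (x∈p⇒p-x⊂p x∈p)))
  ... | no empty = subst P (sym (Empty-unique empty)) base

∣p∪q∣≤∣p∣+∣q∣ : ∀ {n} (p q : Subset n) → ∣ p ∪ q ∣ ≤ ∣ p ∣ + ∣ q ∣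
∣p∪q∣≤∣p∣+∣q∣ [] [] = z≤n
∣p∪q∣≤∣p∣+∣q∣ (inside ∷ p) (inside ∷ q) =
  s≤s (≤-trans (∣p∪q∣≤∣p∣+∣q∣ p q) (≤-trans (n≤1+n _) (≤-reflexive (sym (+-suc ∣ p ∣ ∣ q ∣)))))
∣p∪q∣≤∣p∣+∣q∣ (inside ∷ p) (outside ∷ q) = s≤s (∣p∪q∣≤∣p∣+∣q∣ p q)
∣p∪q∣≤∣p∣+∣q∣ (outside ∷ p) (inside ∷ q) =
  ≤-trans (s≤s (∣p∪q∣≤∣p∣+∣q∣ p q)) (≤-reflexive (sym (+-suc ∣ p ∣ ∣ q ∣)))
∣p∪q∣≤∣p∣+∣q∣ (outside ∷ p) (outside ∷ q) = ∣p∪q∣≤∣p∣+∣q∣ p q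

∣p∣≡∣p∩q∣+∣p─q∣ : ∀ {n} (p q : Subset n) → ∣ p ∣ ≡ ∣ p ∩ q ∣ + ∣ p ─ q ∣
∣p∣≡∣p∩q∣+∣p─q∣ [] [] = refl
∣p∣≡∣p∩q∣+∣p─q∣ (inside ∷ p) (inside ∷ q) = cong suc (∣p∣≡∣p∩q∣+∣p─q∣ p q)
∣p∣≡∣p∩q∣+∣p─q∣ (inside ∷ p) (outside ∷ q) =
  trans (cong suc (∣p∣≡∣p∩q∣+∣p─q∣ p q)) (sym (+-suc ∣ p ∩ q ∣ ∣ p ─ q ∣))
∣p∣≡∣p∩q∣+∣p─q∣ (outside ∷ p) (inside ∷ q) = ∣p∣≡∣p∩q∣+∣p─q∣ p q
∣p∣≡∣p∩q∣+∣p─q∣ (outside ∷ p) (outside ∷ q) = ∣p∣≡∣p∩q∣+∣p─q∣ p q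

∣p∣≤1+∣p-x∣ : ∀ {n} (p : Subset n) x → ∣ p ∣ ≤ suc ∣ p - x ∣
∣p∣≤1+∣p-x∣ p x = begin
  ∣ p ∣                   ≤⟨ p⊆q⇒∣p∣≤∣q∣ (p⊆p-x∪⁅x⁆ p x) ⟩
  ∣ (p - x) ∪ ⁅ x ⁆ ∣     ≤⟨ ∣p∪q∣≤∣p∣+∣q∣ (p - x) ⁅ x ⁆ ⟩
  ∣ p - x ∣ + ∣ ⁅ x ⁆ ∣   ≡⟨ cong (∣ p - x ∣ +_) (∣⁅x⁆∣≡1 x) ⟩
  ∣ p - x ∣ + 1           ≡⟨ +-comm ∣ p - x ∣ 1 ⟩
  suc ∣ p - x ∣           ∎
  where open ≤-Reasoning

x∈⋃⁺ : ∀ {n x} {p : Subset n} {ps} → x ∈ p → p ∈ₗ ps → x ∈ ⋃ ps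
x∈⋃⁺ x∈p (here refl) = x∈p∪q⁺ (inj₁ x∈p)
x∈⋃⁺ x∈p (there p∈ps) = x∈p∪q⁺ (inj₂ (x∈⋃⁺ x∈p p∈ps))

∣⋃ps∣≤sum : ∀ {n} (ps : List (Subset n)) → ∣ ⋃ ps ∣ ≤ sum (map ∣_∣ ps)
∣⋃ps∣≤sum {n} [] = ≤-reflexive (∣⊥∣≡0 n)
∣⋃ps∣≤sum (p ∷ ps) = ≤-trans (∣p∪q∣≤∣p∣+∣q∣ p (⋃ ps)) (+-monoʳ-≤ ∣ p ∣ (∣⋃ps∣≤sum ps))

weight : ∀ {n} → Subset n → (Fin n → ℕ) → ℕ
weight {n} S h = sum (map (λ v → if lookup S v then h v else 0) (allFin n))

weight-∷ : ∀ {n} s (S : Subset n) h →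
  weight (s ∷ S) h ≡ (if s then h zero else 0) + weight S (h ∘ suc)
weight-∷ {n} s S h = cong (λ xs → (if s then h zero else 0) + sum xs)
  (trans (map-tabulate suc φ) (sym (map-tabulate (λ v → v) (φ ∘ suc))))
  where
  φ : Fin (suc n) → ℕ
  φ v = if lookup (s ∷ S) v then h v else 0

weight-⊥ : ∀ {n} (h : Fin n → ℕ) → weight ⊥ h ≡ 0
weight-⊥ {zero} h = refl
weight-⊥ {suc n} h = trans (weight-∷ outside ⊥ h) (weight-⊥ (h ∘ suc))

weight-⁅⁆ : ∀ {n} (v : Fin n) h → weight ⁅ v ⁆ h ≡ h v
weight-⁅⁆ zero h = trans (weight-∷ inside ⊥ h) (trans (cong (h zero +_) (weight-⊥ (h ∘ suc))) (+-identityʳ (h zero)))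
weight-⁅⁆ (suc v) h = trans (weight-∷ outside ⁅ v ⁆ h) (weight-⁅⁆ v (h ∘ suc))

weight-modular : ∀ {n} (S S' : Subset n) h →
  weight (S ∪ S') h + weight (S ∩ S') h ≡ weight S h + weight S' h
weight-modular [] [] h = refl
weight-modular (s ∷ S) (s' ∷ S') h = begin
  weight ((s ∷ S) ∪ (s' ∷ S')) h + weight ((s ∷ S) ∩ (s' ∷ S')) h
    ≡⟨ cong₂ _+_ (weight-∷ (s ∨ s') (S ∪ S') h) (weight-∷ (s ∧ s') (S ∩ S') h) ⟩
  ([ s ∨ s' ] + rest∪) + ([ s ∧ s' ] + rest∩)
    ≡⟨ +-assoc-swap [ s ∨ s' ] rest∪ [ s ∧ s' ] rest∩ ⟩
  ([ s ∨ s' ] + [ s ∧ s' ]) + (rest∪ + rest∩)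
    ≡⟨ cong₂ _+_ (first s s') (weight-modular S S' (h ∘ suc)) ⟩
  ([ s ] + [ s' ]) + (weight S (h ∘ suc) + weight S' (h ∘ suc))
    ≡⟨ sym (+-assoc-swap [ s ] (weight S (h ∘ suc)) [ s' ] (weight S' (h ∘ suc))) ⟩
  ([ s ] + weight S (h ∘ suc)) + ([ s' ] + weight S' (h ∘ suc))
    ≡⟨ sym (cong₂ _+_ (weight-∷ s S h) (weight-∷ s' S' h)) ⟩
  weight (s ∷ S) h + weight (s' ∷ S') h ∎
  where
  open ≡-Reasoning
  [_] : Bool → ℕ
  [ b ] = if b then h zero else 0
  rest∪ rest∩ : ℕ
  rest∪ = weight (S ∪ S') (h ∘ suc)
  rest∩ = weight (S ∩ S') (h ∘ suc)
  +-assoc-swap : ∀ w x y z → (w + x) + (y + z) ≡ (w + y) + (x + z)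
  +-assoc-swap = solve-∀
  first : ∀ s s' → [ s ∨ s' ] + [ s ∧ s' ] ≡ [ s ] + [ s' ]
  first true true = refl
  first true false = refl
  first false true = +-identityʳ (h zero)
  first false false = refl

weight-∪⁅⁆ : ∀ {n} (S : Subset n) v h → weight (S ∪ ⁅ v ⁆) h ≤ weight S h + h v
weight-∪⁅⁆ S v h = begin
  weight (S ∪ ⁅ v ⁆) h                              ≤⟨ m≤m+n _ _ ⟩
  weight (S ∪ ⁅ v ⁆) h + weight (S ∩ ⁅ v ⁆) h       ≡⟨ weight-modular S ⁅ v ⁆ h ⟩
  weight S h + weight ⁅ v ⁆ h                       ≡⟨ cong (weight S h +_) (weight-⁅⁆ v h) ⟩
  weight S h + h v                                  ∎
  where open ≤-Reasoning

sum-map-mono : ∀ {a} {A : Set a} {f g : A → ℕ} (xs : List A) →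
  (∀ x → f x ≤ g x) → sum (map f xs) ≤ sum (map g xs)
sum-map-mono [] f≤g = z≤n
sum-map-mono (x ∷ xs) f≤g = +-mono-≤ (f≤g x) (sum-map-mono xs f≤g)

module Walks (G : Graph) where

  Vertex : Set
  Vertex = Fin (n G)

  end₁ end₂ : Fin (m G) → Vertex
  end₁ e = proj₁ (ends G e)
  end₂ e = proj₂ (ends G e)

  joins-ends : ∀ e → Joins G e (end₁ e) (end₂ e)
  joins-ends e = inj₁ (refl , refl)

  joins-sym : ∀ {e u w} → Joins G e u w → Joins G e w u
  joins-sym (inj₁ uw) = inj₂ uw
  joins-sym (inj₂ wu) = inj₁ wu

  joins-ends⁻ : ∀ {e u w} → Joins G e u w → (u ≡ end₁ e × w ≡ end₂ e) ⊎ (u ≡ end₂ e × w ≡ end₁ e)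
  joins-ends⁻ (inj₁ (refl , refl)) = inj₁ (refl , refl)
  joins-ends⁻ (inj₂ (refl , refl)) = inj₂ (refl , refl)

  edgeʷ : ∀ {E e u w} → e ∈ E → Joins G e u w → Walk G E u w
  edgeʷ e∈E j = cons _ e∈E j nil

  _++ʷ_ : ∀ {E u w v} → Walk G E u w → Walk G E w v → Walk G E u v
  nil ++ʷ q = q
  cons e e∈E j p ++ʷ q = cons e e∈E j (p ++ʷ q)

  reverseʷ : ∀ {E u v} → Walk G E u v → Walk G E v u
  reverseʷ nil = nil
  reverseʷ (cons e e∈E j p) = reverseʷ p ++ʷ edgeʷ e∈E (joins-sym j)

  liftʷ : ∀ {E E'} → E ⊆ E' → ∀ {u v} → Walk G E u v → Walk G E' u v
  liftʷ E⊆E' nil = nil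
  liftʷ E⊆E' (cons e e∈E j p) = cons e (E⊆E' e∈E) j (liftʷ E⊆E' p)

  replaceʷ : ∀ {A T} → (∀ {e} → e ∈ A → Walk G T (end₁ e) (end₂ e)) →
    ∀ {u v} → Walk G A u v → Walk G T u v
  replaceʷ r nil = nil
  replaceʷ r (cons e e∈A j p) with joins-ends⁻ j
  ... | inj₁ (refl , refl) = r e∈A ++ʷ replaceʷ r p
  ... | inj₂ (refl , refl) = reverseʷ (r e∈A) ++ʷ replaceʷ r p

-- Merging label j into label i of a labelling with k + 1 labels.
merge : ∀ {k} (i j : Fin (suc k)) → i ≢ j → Fin (suc k) → Fin k
merge i j i≢j l with l ≟ j
... | yes _ = punchOut {i = j} {j = i} (λ j≡i → i≢j (sym j≡i))
... | no l≢j = punchOut {i = j} {j = l} (λ j≡l → l≢j (sym j≡l))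

merge-identifies : ∀ {k} (i j : Fin (suc k)) (i≢j : i ≢ j) → merge i j i≢j i ≡ merge i j i≢j j
merge-identifies i j i≢j with i ≟ j | j ≟ j
... | yes i≡j | _ = ⊥-elim (i≢j i≡j)
... | no _ | no j≢j = ⊥-elim (j≢j refl)
... | no _ | yes _ = punchOut-cong j refl

merge-inv : ∀ {k} (i j : Fin (suc k)) (i≢j : i ≢ j) l l' → merge i j i≢j l ≡ merge i j i≢j l' →
  l ≡ l' ⊎ ((l ≡ i × l' ≡ j) ⊎ (l ≡ j × l' ≡ i))
merge-inv i j i≢j l l' eq with l ≟ j | l' ≟ j
... | yes l≡j | yes l'≡j = inj₁ (trans l≡j (sym l'≡j))
... | yes l≡j | no _ = inj₂ (inj₂ (l≡j , sym (punchOut-injective {i = j} _ _ eq)))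
... | no _ | yes l'≡j = inj₂ (inj₁ (punchOut-injective {i = j} _ _ eq , l'≡j))
... | no _ | no _ = inj₁ (punchOut-injective {i = j} _ _ eq)

merge-punchIn : ∀ {k} (i j : Fin (suc k)) (i≢j : i ≢ j) t → merge i j i≢j (punchIn j t) ≡ t
merge-punchIn i j i≢j t with punchIn j t ≟ j
... | yes eq = ⊥-elim (punchInᵢ≢i j t eq)
... | no _ = trans (punchOut-cong j refl) (punchOut-punchIn j)

module Components (G : Graph) where
  open Walks G

  module _ {E : EdgeSet G} {k : ℕ} (c : HasComponents G E k) where
    label : Vertex → Fin k
    label = proj₁ c

    label⇒walk : ∀ {u v} → label u ≡ label v → Walk G E u v
    label⇒walk {u} {v} = Equivalence.to (proj₂ (proj₂ c) u v)

    walk⇒label : ∀ {u v} → Walk G E u v → label u ≡ label v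
    walk⇒label {u} {v} = Equivalence.from (proj₂ (proj₂ c) u v)

    representative : Fin k → Vertex
    representative i = proj₁ (proj₁ (proj₂ c) i)

    label-representative : ∀ i → label (representative i) ≡ i
    label-representative i = proj₂ (proj₁ (proj₂ c) i) refl

  -- If every walk of E can be turned into one of E', then E' has at
  -- most as many components as E: representatives of distinct
  -- E'-components lie in distinct E-components.
  components-≤ : ∀ {E E' k k'} → (∀ {u v} → Walk G E u v → Walk G E' u v) →
    HasComponents G E k → HasComponents G E' k' → k' ≤ k
  components-≤ {k' = k'} E→E' c c' = injective⇒≤ {f = f} f-injective
    where
    f : Fin k' → Fin _
    f i = label c (representative c' i)
    f-injective : ∀ {i j} → f i ≡ f j → i ≡ j
    f-injective {i} {j} eq = trans (sym (label-representative c' i))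
      (trans (walk⇒label c' (E→E' (label⇒walk c eq))) (label-representative c' j))

  no-edges : ∀ {E} → (∀ e → e ∉ E) → HasComponents G E (n G)
  no-edges {E} ∄e = (λ u → u) , (λ i → i , λ eq → eq) , λ u v → mk⇔ (λ { refl → nil }) trivial
    where
    trivial : ∀ {u v} → Walk G E u v → u ≡ v
    trivial nil = refl
    trivial (cons e e∈E _ _) = ⊥-elim (∄e e e∈E)

  -- A walk in E ∪ {e} is a walk in E except for its steps along e; so
  -- a map f on labels identifying the labels of the ends of e is
  -- constant along it.
  label-∪⁅⁆ : ∀ {E e k} (c : HasComponents G E k) {A : Set} (f : Fin k → A) →
    f (label c (end₁ e)) ≡ f (label c (end₂ e)) →
    ∀ {u v} → Walk G (E ∪ ⁅ e ⁆) u v → f (label c u) ≡ f (label c v)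
  label-∪⁅⁆ c f f-e nil = refl
  label-∪⁅⁆ {E} {e} c f f-e (cons g g∈ j p) with x∈p∪q⁻ E ⁅ e ⁆ g∈
  ... | inj₁ g∈E = trans (cong f (walk⇒label c (edgeʷ g∈E j))) (label-∪⁅⁆ c f f-e p)
  ... | inj₂ g∈⁅e⁆ rewrite x∈⁅y⁆⇒x≡y e g∈⁅e⁆ with joins-ends⁻ j
  ...   | inj₁ (refl , refl) = trans f-e (label-∪⁅⁆ c f f-e p)
  ...   | inj₂ (refl , refl) = trans (sym f-e) (label-∪⁅⁆ c f f-e p)

  add-within : ∀ {E e k} → HasComponents G E k → Walk G E (end₁ e) (end₂ e) →
    HasComponents G (E ∪ ⁅ e ⁆) k
  add-within {E} {e} c w = label c , proj₁ (proj₂ c) , λ u v →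
    mk⇔ (λ eq → liftʷ (p⊆p∪q ⁅ e ⁆) (label⇒walk c eq))
        (label-∪⁅⁆ {e = e} c (λ i → i) (walk⇒label c w))

  add-between : ∀ {E e k} (c : HasComponents G E (suc k)) → ¬ Walk G E (end₁ e) (end₂ e) →
    HasComponents G (E ∪ ⁅ e ⁆) k
  add-between {E} {e} {k} c no-walk =
    label' , onto , λ u v → mk⇔ (to u v) (label-∪⁅⁆ {e = e} c mrg (merge-identifies i j i≢j))
    where
    i j : Fin (suc k)
    i = label c (end₁ e)
    j = label c (end₂ e)
    i≢j : i ≢ j
    i≢j eq = no-walk (label⇒walk c eq)
    mrg : Fin (suc k) → Fin k
    mrg = merge i j i≢j
    label' : Vertex → Fin k
    label' u = mrg (label c u)
    onto : ∀ t → ∃ λ u → ∀ {z} → z ≡ u → label' z ≡ t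
    onto t = representative c (punchIn j t) , λ { refl →
      trans (cong mrg (label-representative c _)) (merge-punchIn i j i≢j t) }
    E⊆ : E ⊆ E ∪ ⁅ e ⁆
    E⊆ = p⊆p∪q ⁅ e ⁆
    e-walk : Walk G (E ∪ ⁅ e ⁆) (end₁ e) (end₂ e)
    e-walk = edgeʷ (x∈p∪q⁺ (inj₂ (x∈⁅x⁆ e))) (joins-ends e)
    to : ∀ u v → label' u ≡ label' v → Walk G (E ∪ ⁅ e ⁆) u v
    to u v eq with merge-inv i j i≢j _ _ eq
    ... | inj₁ same = liftʷ E⊆ (label⇒walk c same)
    ... | inj₂ (inj₁ (u∼i , v∼j)) =
      liftʷ E⊆ (label⇒walk c u∼i) ++ʷ (e-walk ++ʷ liftʷ E⊆ (label⇒walk c (sym v∼j)))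
    ... | inj₂ (inj₂ (u∼j , v∼i)) =
      liftʷ E⊆ (label⇒walk c u∼j) ++ʷ (reverseʷ e-walk ++ʷ liftʷ E⊆ (label⇒walk c (sym v∼i)))

  add-edge : ∀ {E} e → Σ ℕ (HasComponents G E) → Σ ℕ (HasComponents G (E ∪ ⁅ e ⁆))
  add-edge e (zero , c) with label c (end₁ e)
  ... | ()
  add-edge e (suc k , c) with label c (end₁ e) ≟ label c (end₂ e)
  ... | yes same = suc k , add-within c (label⇒walk c same)
  ... | no differ = k , add-between c (λ w → differ (walk⇒label c w))

  -- Every spanning subgraph has a component labelling: remove an edge,
  -- label the rest, and put the edge back.
  components-exist : ∀ E → Σ ℕ (HasComponents G E)
  components-exist = subset-induction (λ E → Σ ℕ (HasComponents G E))
    (n G , no-edges (λ e → ∉⊥))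
    (λ {E} {e} e∈E labelled → subst (λ E' → Σ ℕ (HasComponents G E')) (p-x∪⁅x⁆≡p e∈E) (add-edge e labelled))

  ω : EdgeSet G → ℕ
  ω E = proj₁ (components-exist E)

  ω-components : ∀ E → HasComponents G E (ω E)
  ω-components E = proj₂ (components-exist E)

  ω-unique : ∀ {E k} → HasComponents G E k → k ≡ ω E
  ω-unique c = ≤-antisym (components-≤ (λ w → w) (ω-components _) c)
                         (components-≤ (λ w → w) c (ω-components _))

  ω-antiʷ : ∀ {E E'} → (∀ {u v} → Walk G E u v → Walk G E' u v) → ω E' ≤ ω E
  ω-antiʷ E→E' = components-≤ E→E' (ω-components _) (ω-components _)

  ω-anti : ∀ {E E'} → E ⊆ E' → ω E' ≤ ω E
  ω-anti E⊆E' = ω-antiʷ (liftʷ E⊆E')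

  connected? : ∀ E u v → Dec (Walk G E u v)
  connected? E u v with label (ω-components E) u ≟ label (ω-components E) v
  ... | yes same = yes (label⇒walk (ω-components E) same)
  ... | no differ = no (λ w → differ (walk⇒label (ω-components E) w))

  ω-add-within : ∀ {E e} → Walk G E (end₁ e) (end₂ e) → ω (E ∪ ⁅ e ⁆) ≡ ω E
  ω-add-within w = sym (ω-unique (add-within (ω-components _) w))

  ω-add-bridge : ∀ {E e} → ¬ Walk G E (end₁ e) (end₂ e) → suc (ω (E ∪ ⁅ e ⁆)) ≡ ω E
  ω-add-bridge {E} {e} no-walk with ω E | ω-components E
  ... | zero | c with label c (end₁ e)
  ...   | ()
  ω-add-bridge {E} {e} no-walk | suc k | c = cong suc (sym (ω-unique (add-between c no-walk)))

  ω-add : ∀ E e → ω E ≤ suc (ω (E ∪ ⁅ e ⁆))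
  ω-add E e with connected? E (end₁ e) (end₂ e)
  ... | yes w = ≤-trans (≤-reflexive (sym (ω-add-within w))) (n≤1+n _)
  ... | no no-walk = ≤-reflexive (sym (ω-add-bridge no-walk))

  ω≤1⇒connected : ∀ {E} → ω E ≤ 1 → ∀ u v → Walk G E u v
  ω≤1⇒connected {E} ω≤1 u v = label⇒walk (ω-components E) (all-equal (ω E) ω≤1 _ _)
    where
    all-equal : ∀ k → k ≤ 1 → (i j : Fin k) → i ≡ j
    all-equal (suc zero) _ zero zero = refl
    all-equal (suc (suc k)) (s≤s ()) _ _

  connected⇒ω≤1 : ∀ {E} → (∀ u v → Walk G E u v) → ω E ≤ 1
  connected⇒ω≤1 {E} conn with ω E | ω-components E
  ... | zero | _ = z≤n
  ... | suc zero | _ = s≤s z≤n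
  ... | suc (suc k) | c with walk⇒label c (conn (representative c zero) (representative c (suc zero)))
  ...   | eq with () ← trans (sym (label-representative c zero)) (trans eq (label-representative c (suc zero)))

  ω≥1 : ∀ {E} → Vertex → 1 ≤ ω E
  ω≥1 {E} v with ω E | ω-components E
  ... | zero | c with label c v
  ...   | ()
  ω≥1 {E} v | suc k | _ = s≤s z≤n

module Forests (G : Graph) where
  open Walks G
  open Components G

  module _ {E : EdgeSet G} {e : Fin (m G)} where
    SameWalk : ∀ {u v} → Walk G (E ∪ ⁅ e ⁆) u v → Set
    SameWalk {u} {v} w = Σ (Walk G E u v) λ w' →
      walkEdges w' ≡ walkEdges w × walkStarts w' ≡ walkStarts w × isNil w' ≡ isNil w

    avoid : ∀ {u v} (w : Walk G (E ∪ ⁅ e ⁆) u v) → e ∉ₗ walkEdges w → SameWalk w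
    avoid nil _ = nil , refl , refl , refl
    avoid (cons f f∈ j w) e∉ with x∈p∪q⁻ E ⁅ e ⁆ f∈
    ... | inj₂ f∈⁅e⁆ = ⊥-elim (e∉ (here (sym (x∈⁅y⁆⇒x≡y e f∈⁅e⁆))))
    ... | inj₁ f∈E with avoid w (λ e∈ → e∉ (there e∈))
    ...   | w' , same-edges , same-starts , _ =
      cons f f∈E j w' , cong (f ∷_) same-edges , cong (_ ∷_) same-starts , refl

    record SplitAt (u v : Vertex) : Set where
      field
        {x y} : Vertex
        before : Walk G (E ∪ ⁅ e ⁆) u x
        step : Joins G e x y
        after : Walk G (E ∪ ⁅ e ⁆) y v
        e∉before : e ∉ₗ walkEdges before
        e∉after : e ∉ₗ walkEdges after

    split : ∀ {u v} (w : Walk G (E ∪ ⁅ e ⁆) u v) → Unique (walkEdges w) → e ∈ₗ walkEdges w → SplitAt u v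
    split (cons f _ j w) (f∉rest ∷ _) (here refl) = record
      { before = nil ; step = j ; after = w ; e∉before = λ () ; e∉after = All¬⇒¬Any f∉rest }
    split (cons f f∈ j w) (f∉rest ∷ unique) (there e∈) = record
      { before = cons f f∈ j before ; step = step ; after = after
      ; e∉before = λ { (here refl) → lookupᴬ f∉rest e∈ refl ; (there e∈') → e∉before e∈' }
      ; e∉after = e∉after }
      where open SplitAt (split w unique e∈)

  -- Adding an edge between two components of a forest creates no cycle:
  -- a cycle through e would leave a walk between its ends avoiding e.
  forest-add : ∀ {E e} → IsForest G E → ¬ Walk G E (end₁ e) (end₂ e) → IsForest G (E ∪ ⁅ e ⁆)
  forest-add {E} {e} forest no-walk (v , c , nonempty , unique-edges , unique-starts) with anyₗ? (e ≟_) (walkEdges c)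
  ... | no e∉c with avoid c e∉c
  ...   | c' , same-edges , same-starts , same-nil =
    forest (v , c' , subst (_≡ _) (sym same-nil) nonempty
               , subst Unique (sym same-edges) unique-edges
               , subst Unique (sym same-starts) unique-starts)
  forest-add {E} {e} forest no-walk (v , c , _ , unique-edges , _) | yes e∈c
    with split c unique-edges e∈c
  ... | s with avoid (SplitAt.before s) (SplitAt.e∉before s)
             | avoid (SplitAt.after s) (SplitAt.e∉after s)
             | joins-ends⁻ (SplitAt.step s)
  ...   | before , _ | after , _ | inj₁ (refl , refl) = no-walk (reverseʷ (after ++ʷ before))
  ...   | before , _ | after , _ | inj₂ (refl , refl) = no-walk (after ++ʷ before)

  SpanningForest : EdgeSet G → EdgeSet G → EdgeSet G → Set
  SpanningForest F A T = F ⊆ T × T ⊆ A × IsForest G T × (∀ {e} → e ∈ A → Walk G T (end₁ e) (end₂ e))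

  spanning-forest : ∀ {F A} → F ⊆ A → IsForest G F → Σ (EdgeSet G) (SpanningForest F A)
  spanning-forest {F} {A} F⊆A F-forest = grow F (λ f∈ → f∈) F⊆A F-forest (⊃-wellFounded F)
    where
    grow : ∀ T → F ⊆ T → T ⊆ A → IsForest G T → Acc _⊃_ T → Σ (EdgeSet G) (SpanningForest F A)
    grow T F⊆T T⊆A T-forest (acc larger)
      with any? (λ e → (e ∈? A) ×-dec ¬? (connected? T (end₁ e) (end₂ e)))
    ... | yes (e , e∈A , no-walk) =
      grow (T ∪ ⁅ e ⁆) (λ f∈ → p⊆p∪q ⁅ e ⁆ (F⊆T f∈)) T∪e⊆A (forest-add T-forest no-walk)
           (larger (p⊆p∪q ⁅ e ⁆ , e , e∈T∪e , e∉T))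
      where
      e∈T∪e : e ∈ T ∪ ⁅ e ⁆
      e∈T∪e = x∈p∪q⁺ (inj₂ (x∈⁅x⁆ e))
      e∉T : e ∉ T
      e∉T e∈T = no-walk (edgeʷ e∈T (joins-ends e))
      T∪e⊆A : T ∪ ⁅ e ⁆ ⊆ A
      T∪e⊆A f∈ with x∈p∪q⁻ T ⁅ e ⁆ f∈
      ... | inj₁ f∈T = T⊆A f∈T
      ... | inj₂ f∈⁅e⁆ rewrite x∈⁅y⁆⇒x≡y e f∈⁅e⁆ = e∈A
    ... | no saturated = T , F⊆T , T⊆A , T-forest , connects
      where
      connects : ∀ {e} → e ∈ A → Walk G T (end₁ e) (end₂ e)
      connects {e} e∈A with connected? T (end₁ e) (end₂ e)
      ... | yes w = w
      ... | no no-walk = ⊥-elim (saturated (e , e∈A , no-walk))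

≤-combine : ∀ a b x y z w → a + x ≤ b + y → y + z ≤ x + w → a + z ≤ b + w
≤-combine a b x y z w p q = +-cancelʳ-≤ (x + y) (a + z) (b + w) (begin
  (a + z) + (x + y)   ≡⟨ regroupˡ a x y z ⟩
  (a + x) + (y + z)   ≤⟨ +-mono-≤ p q ⟩
  (b + y) + (x + w)   ≡⟨ regroupʳ b x y w ⟩
  (b + w) + (x + y)   ∎)
  where
  open ≤-Reasoning
  regroupˡ : ∀ a x y z → (a + z) + (x + y) ≡ (a + x) + (y + z)
  regroupˡ = solve-∀
  regroupʳ : ∀ b x y w → (b + y) + (x + w) ≡ (b + w) + (x + y)
  regroupʳ = solve-∀

module ComponentCounting (G : Graph) where
  open Walks G
  open Components G

  ω-add-anti : ∀ {D D'} e → D ⊆ D' → ω D' + ω (D ∪ ⁅ e ⁆) ≤ ω D + ω (D' ∪ ⁅ e ⁆)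
  ω-add-anti {D} {D'} e D⊆D' with connected? D (end₁ e) (end₂ e) | connected? D' (end₁ e) (end₂ e)
  ... | yes w | _ rewrite ω-add-within w | ω-add-within (liftʷ D⊆D' w) = ≤-reflexive (+-comm (ω D') (ω D))
  ... | no no-walk | yes w' rewrite ω-add-within w' | sym (ω-add-bridge no-walk) =
    ≤-trans (≤-reflexive (+-comm (ω D') _)) (n≤1+n _)
  ... | no no-walk | no no-walk' rewrite sym (ω-add-bridge no-walk) | sym (ω-add-bridge no-walk') =
    ≤-reflexive (trans (+-comm (suc (ω (D' ∪ ⁅ e ⁆))) _) (+-suc _ _))

  ω-union-anti : ∀ {D D'} → D ⊆ D' → ∀ B → ω D' + ω (D ∪ B) ≤ ω D + ω (D' ∪ B)
  ω-union-anti {D} {D'} D⊆D' = subset-induction (λ B → ω D' + ω (D ∪ B) ≤ ω D + ω (D' ∪ B))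
    (subst (λ E → ω D' + ω E ≤ ω D + ω (D' ∪ ⊥)) (sym (∪-identityʳ D))
      (subst (λ E → ω D' + ω D ≤ ω D + ω E) (sym (∪-identityʳ D')) (≤-reflexive (+-comm (ω D') (ω D)))))
    step
    where
    step : ∀ {B e} → e ∈ B → ω D' + ω (D ∪ (B - e)) ≤ ω D + ω (D' ∪ (B - e)) →
      ω D' + ω (D ∪ B) ≤ ω D + ω (D' ∪ B)
    step {B} {e} e∈B ih rewrite ∪-insert D e∈B | ∪-insert D' e∈B =
      ≤-combine (ω D') (ω D) (ω (D ∪ (B - e))) (ω (D' ∪ (B - e))) _ _ ih
        (ω-add-anti e (∪-monoˡ-⊆ (B - e) D⊆D'))

  ω-submodular : ∀ B₁ B₂ → ω B₁ + ω B₂ ≤ ω (B₁ ∩ B₂) + ω (B₁ ∪ B₂)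
  ω-submodular B₁ B₂ = subst (λ B → ω B₁ + ω B ≤ ω (B₁ ∩ B₂) + ω (B₁ ∪ B₂)) absorb
    (ω-union-anti (p∩q⊆p B₁ B₂) B₂)
    where
    absorb : (B₁ ∩ B₂) ∪ B₂ ≡ B₂
    absorb = trans (∪-comm (B₁ ∩ B₂) B₂) (trans (cong (B₂ ∪_) (∩-comm B₁ B₂)) (∪-abs-∩ B₂ B₁))

  -- Each edge of B removed from D ∪ B splits off at most one component.
  ω-union-bound : ∀ D B → ω D ≤ ω (D ∪ B) + ∣ B ∣
  ω-union-bound D = subset-induction (λ B → ω D ≤ ω (D ∪ B) + ∣ B ∣)
    (≤-reflexive (sym (trans (cong₂ _+_ (cong ω (∪-identityʳ D)) (∣⊥∣≡0 (m G))) (+-identityʳ (ω D)))))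
    step
    where
    step : ∀ {B e} → e ∈ B → ω D ≤ ω (D ∪ (B - e)) + ∣ B - e ∣ → ω D ≤ ω (D ∪ B) + ∣ B ∣
    step {B} {e} e∈B ih = begin
      ω D                                  ≤⟨ ih ⟩
      ω (D ∪ (B - e)) + ∣ B - e ∣           ≤⟨ +-monoˡ-≤ ∣ B - e ∣ (ω-add (D ∪ (B - e)) e) ⟩
      suc (ω ((D ∪ (B - e)) ∪ ⁅ e ⁆)) + ∣ B - e ∣ ≡⟨ cong (λ E → suc (ω E) + ∣ B - e ∣) (sym (∪-insert D e∈B)) ⟩
      suc (ω (D ∪ B)) + ∣ B - e ∣           ≡⟨ sym (+-suc (ω (D ∪ B)) ∣ B - e ∣) ⟩
      ω (D ∪ B) + suc ∣ B - e ∣             ≤⟨ +-monoʳ-≤ (ω (D ∪ B)) (x∈p⇒∣p-x∣<∣p∣ e∈B) ⟩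
      ω (D ∪ B) + ∣ B ∣                     ∎
      where open ≤-Reasoning

  IsBridge : EdgeSet G → Fin (m G) → Set
  IsBridge B e = ¬ Walk G (B - e) (end₁ e) (end₂ e)

  -- Deleting a set Q of bridges of B creates ∣Q∣ new components: each
  -- one stays a bridge after the others are gone.
  ω-remove-bridges : ∀ B Q → Q ⊆ B → (∀ {e} → e ∈ Q → IsBridge B e) → ω B + ∣ Q ∣ ≤ ω (B ─ Q)
  ω-remove-bridges B = subset-induction P base step
    where
    P : Subset (m G) → Set
    P Q = Q ⊆ B → (∀ {e} → e ∈ Q → IsBridge B e) → ω B + ∣ Q ∣ ≤ ω (B ─ Q)
    base : P ⊥
    base _ _ = ≤-reflexive (trans (cong (ω B +_) (∣⊥∣≡0 (m G))) (trans (+-identityʳ (ω B)) (cong ω (sym (p─⊥≡p B)))))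
    step : ∀ {Q e} → e ∈ Q → P (Q - e) → P Q
    step {Q} {e} e∈Q ih Q⊆B bridges = begin
      ω B + ∣ Q ∣                    ≤⟨ +-monoʳ-≤ (ω B) (∣p∣≤1+∣p-x∣ Q e) ⟩
      ω B + suc ∣ Q - e ∣             ≡⟨ +-suc (ω B) ∣ Q - e ∣ ⟩
      suc (ω B + ∣ Q - e ∣)           ≤⟨ s≤s (ih (λ f∈ → Q⊆B (p─q⊆p Q ⁅ e ⁆ f∈)) (λ f∈ → bridges (p─q⊆p Q ⁅ e ⁆ f∈))) ⟩
      suc (ω (B ─ (Q - e)))           ≡⟨ cong (λ E → suc (ω E)) (─-insert Q (Q⊆B e∈Q)) ⟩
      suc (ω ((B ─ Q) ∪ ⁅ e ⁆))       ≡⟨ ω-add-bridge (λ w → bridges e∈Q (liftʷ (p─q⊆p-x B e∈Q) w)) ⟩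
      ω (B ─ Q)                       ∎
      where open ≤-Reasoning

  bridge-anti : ∀ {B B' e} → B' ⊆ B → IsBridge B e → IsBridge B' e
  bridge-anti {B} {B'} {e} B'⊆B bridge w = bridge (liftʷ B'-e⊆B-e w)
    where
    B'-e⊆B-e : B' - e ⊆ B - e
    B'-e⊆B-e f∈ = x∈p∧x≢y⇒x∈p-y (B'⊆B (p─q⊆p B' ⁅ e ⁆ f∈)) (x∈p-y⇒x≢y B' e f∈)

  bound-broken : ∀ {B e k} → ω B ≤ k → k < ω (B - e) → (e ∈ B) × IsBridge B e × (k ≤ ω B)
  bound-broken {B} {e} {k} ωB≤k k<ω with e ∈? B
  ... | no e∉B = ⊥-elim (<⇒≱ k<ω (≤-trans (ω-anti B⊆B-e) ωB≤k))
    where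
    B⊆B-e : B ⊆ B - e
    B⊆B-e f∈ = x∈p∧x≢y⇒x∈p-y f∈ (λ { refl → e∉B f∈ })
  ... | yes e∈B = e∈B , bridge , ≤-pred (begin-strict
      k                           <⟨ k<ω ⟩
      ω (B - e)                   ≡⟨ sym (ω-add-bridge bridge) ⟩
      suc (ω ((B - e) ∪ ⁅ e ⁆))   ≤⟨ s≤s (ω-anti (p⊆p-x∪⁅x⁆ B e)) ⟩
      suc (ω B)                   ∎)
    where
    open ≤-Reasoning
    bridge : IsBridge B e
    bridge w = <⇒≱ k<ω (begin
      ω (B - e)                   ≡⟨ sym (ω-add-within w) ⟩
      ω ((B - e) ∪ ⁅ e ⁆)         ≤⟨ ω-anti (p⊆p-x∪⁅x⁆ B e) ⟩
      ω B                         ≤⟨ ωB≤k ⟩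
      k                           ∎)

kept-bool : ∀ a b c → ((not a ∧ not b) ∨ c) ≡ true → c ≡ true ⊎ (a ≡ false × b ≡ false)
kept-bool false false c _ = inj₂ (refl , refl)
kept-bool true b true _ = inj₁ refl
kept-bool false true true _ = inj₁ refl

module Setting (G : Graph) (F : EdgeSet G) (F-forest : IsForest G F) (X : VSet G) (X-F : eZero G X F)
               (h : Fin (n G) → ℕ) where
  open Walks G
  open Forests G
  open Components G
  open ComponentCounting G

  Kept : VSet G → Fin (m G) → Set
  Kept S f = f ∈ F ⊎ (end₁ f ∉ S × end₂ f ∉ S)

  ∈-removeExcept⁺ : ∀ {S f} → Kept S f → f ∈ removeExcept G S F
  ∈-removeExcept⁺ {S} {f} (inj₁ f∈F) = ∈-tabulate⁺ (trans (cong (_ ∨_) ([]=⇒lookup f∈F)) (∨-zeroʳ _))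
  ∈-removeExcept⁺ {S} {f} (inj₂ (a∉S , b∉S)) = ∈-tabulate⁺
    (cong₂ (λ a b → (not a ∧ not b) ∨ lookup F f) (∉⇒lookup≡false S a∉S) (∉⇒lookup≡false S b∉S))

  ∈-removeExcept⁻ : ∀ {S f} → f ∈ removeExcept G S F → Kept S f
  ∈-removeExcept⁻ {S} {f} f∈ with kept-bool (lookup S (end₁ f)) (lookup S (end₂ f)) (lookup F f) (∈-tabulate⁻ f∈)
  ... | inj₁ f∈F = inj₁ (lookup⇒[]= f F f∈F)
  ... | inj₂ (a∉S , b∉S) = inj₂ (lookup≡false⇒∉ S a∉S , lookup≡false⇒∉ S b∉S)

  Kept-anti : ∀ {S S' f} → S ⊆ S' → Kept S' f → Kept S f
  Kept-anti S⊆S' (inj₁ f∈F) = inj₁ f∈F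
  Kept-anti S⊆S' (inj₂ (a∉S' , b∉S')) = inj₂ ((λ a∈S → a∉S' (S⊆S' a∈S)) , (λ b∈S → b∉S' (S⊆S' b∈S)))

  -- A ∖[ S ]: the edges of A kept in G ∖ [S, F].
  -- (opaque, so that A and S can be recovered from A ∖[ S ]).
  opaque
    _∖[_] : EdgeSet G → VSet G → EdgeSet G
    A ∖[ S ] = A ∩ removeExcept G S F

    ∈-∖[]⁺ : ∀ {A S f} → f ∈ A → Kept S f → f ∈ A ∖[ S ]
    ∈-∖[]⁺ f∈A kept = x∈p∩q⁺ (f∈A , ∈-removeExcept⁺ kept)

    ∈-∖[]⁻ : ∀ {A S f} → f ∈ A ∖[ S ] → f ∈ A × Kept S f
    ∈-∖[]⁻ {A} {S} f∈ with x∈p∩q⁻ A (removeExcept G S F) f∈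
    ... | f∈A , f∈R = f∈A , ∈-removeExcept⁻ f∈R

  ∖[]-anti : ∀ {A S S'} → S ⊆ S' → A ∖[ S' ] ⊆ A ∖[ S ]
  ∖[]-anti S⊆S' f∈ with ∈-∖[]⁻ f∈
  ... | f∈A , kept = ∈-∖[]⁺ f∈A (Kept-anti S⊆S' kept)

  ∖[]-∪ : ∀ A S S' → (A ∖[ S ]) ∩ (A ∖[ S' ]) ≡ A ∖[ S ∪ S' ]
  ∖[]-∪ A S S' = ⊆-antisym both⊆ (λ f∈ → x∈p∩q⁺ (∖[]-anti (p⊆p∪q S') f∈ , ∖[]-anti (q⊆p∪q S S') f∈))
    where
    both⊆ : (A ∖[ S ]) ∩ (A ∖[ S' ]) ⊆ A ∖[ S ∪ S' ]
    both⊆ f∈ with x∈p∩q⁻ (A ∖[ S ]) (A ∖[ S' ]) f∈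
    ... | f∈₁ , f∈₂ with ∈-∖[]⁻ f∈₁ | ∈-∖[]⁻ f∈₂
    ...   | f∈A , inj₁ f∈F | _ = ∈-∖[]⁺ f∈A (inj₁ f∈F)
    ...   | f∈A , inj₂ _ | _ , inj₁ f∈F = ∈-∖[]⁺ f∈A (inj₁ f∈F)
    ...   | f∈A , inj₂ (a∉S , b∉S) | _ , inj₂ (a∉S' , b∉S') =
      ∈-∖[]⁺ f∈A (inj₂ (∉∪ a∉S a∉S' , ∉∪ b∉S b∉S'))
      where
      ∉∪ : ∀ {x} → x ∉ S → x ∉ S' → x ∉ S ∪ S'
      ∉∪ x∉S x∉S' x∈ with x∈p∪q⁻ S S' x∈
      ... | inj₁ x∈S = x∉S x∈S
      ... | inj₂ x∈S' = x∉S' x∈S'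

  -- When F ⊆ A, an edge kept for S ∩ S' (S, S' ⊆ X) has its ends
  -- connected in (A ∖[ S ]) ∪ (A ∖[ S' ]): otherwise both ends lie in
  -- X, and e_G(X,F) = 0 supplies a walk in F.
  ∖[]-∩-connected : ∀ {A S S'} → F ⊆ A → S ⊆ X → S' ⊆ X → ∀ {f} → f ∈ A ∖[ S ∩ S' ] →
    Walk G ((A ∖[ S ]) ∪ (A ∖[ S' ])) (end₁ f) (end₂ f)
  ∖[]-∩-connected {A} {S} {S'} F⊆A S⊆X S'⊆X {f} f∈ with ∈-∖[]⁻ f∈
  ... | f∈A , inj₁ f∈F = edgeʷ (x∈p∪q⁺ (inj₁ (∈-∖[]⁺ f∈A (inj₁ f∈F)))) (joins-ends f)
  ... | f∈A , inj₂ (a∉ , b∉) with ∉∩-cases a∉ b∉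
  ...   | inj₁ avoids-S = edgeʷ (x∈p∪q⁺ (inj₁ (∈-∖[]⁺ f∈A (inj₂ avoids-S)))) (joins-ends f)
  ...   | inj₂ (inj₁ avoids-S') = edgeʷ (x∈p∪q⁺ (inj₂ (∈-∖[]⁺ f∈A (inj₂ avoids-S')))) (joins-ends f)
  ...   | inj₂ (inj₂ (a∈ , b∈)) = liftʷ F⊆∪ (X-F f (in-X a∈) (in-X b∈))
    where
    F⊆∪ : F ⊆ (A ∖[ S ]) ∪ (A ∖[ S' ])
    F⊆∪ g∈F = x∈p∪q⁺ (inj₁ (∈-∖[]⁺ (F⊆A g∈F) (inj₁ g∈F)))
    in-X : ∀ {x} → x ∈ S ∪ S' → x ∈ X
    in-X x∈ with x∈p∪q⁻ S S' x∈
    ... | inj₁ x∈S = S⊆X x∈S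
    ... | inj₂ x∈S' = S'⊆X x∈S'

  ∈-incident⁻ : ∀ {v e} → e ∈ incident G v → end₁ e ≡ v ⊎ end₂ e ≡ v
  ∈-incident⁻ {v} {e} e∈ with end₁ e ≟ v | end₂ e ≟ v | ∈-tabulate⁻ e∈
  ... | yes end₁≡v | _ | _ = inj₁ end₁≡v
  ... | no _ | yes end₂≡v | _ = inj₂ end₂≡v
  ... | no _ | no _ | ()

  ∈-incident⁺ : ∀ {v e} → end₁ e ≡ v ⊎ end₂ e ≡ v → e ∈ incident G v
  ∈-incident⁺ {v} {e} at-v = ∈-tabulate⁺ (is-incident at-v)
    where
    is-incident : end₁ e ≡ v ⊎ end₂ e ≡ v → (does (end₁ e ≟ v) ∨ does (end₂ e ≟ v)) ≡ true
    is-incident at-v with end₁ e ≟ v | end₂ e ≟ v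
    ... | yes _ | _ = refl
    ... | no _ | yes _ = refl
    is-incident (inj₁ end₁≡v) | no end₁≢v | no _ = ⊥-elim (end₁≢v end₁≡v)
    is-incident (inj₂ end₂≡v) | no _ | no end₂≢v = ⊥-elim (end₂≢v end₂≡v)

  deg≡∣∩incident∣ : ∀ E v → deg G E v ≡ ∣ E ∩ incident G v ∣
  deg≡∣∩incident∣ E v = cong ∣_∣ (tabulate-∧ E (incident G v))

  -- The edges of A at v that are not forest edges; in the tree sought
  -- at most h(v) of them may remain.
  extra : EdgeSet G → Vertex → EdgeSet G
  extra A v = (A ∩ incident G v) ─ F

  ∈-extra⁻ : ∀ {A v e} → e ∈ extra A v → e ∈ A × (end₁ e ≡ v ⊎ end₂ e ≡ v) × e ∉ F
  ∈-extra⁻ {A} {v} e∈ with x∈p∩q⁻ A (incident G v) (p─q⊆p _ F e∈)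
  ... | e∈A , e∈I = e∈A , ∈-incident⁻ e∈I , x∈p─q⇒x∉q _ F e∈

  Feasible : EdgeSet G → Set
  Feasible A = ∀ S → S ⊆ X → ω (A ∖[ S ]) ≤ weight S h + 1

  Tight : EdgeSet G → VSet G → Set
  Tight A S = weight S h + 1 ≤ ω (A ∖[ S ])

  Violation : EdgeSet G → Set
  Violation A = Σ (VSet G) λ S → S ⊆ X × weight S h + 1 < ω (A ∖[ S ])

  feasibility : ∀ A → Feasible A ⊎ Violation A
  feasibility A with anySubset? (λ S → (S ⊆? X) ×-dec (weight S h + 1 <? ω (A ∖[ S ])))
  ... | yes violation = inj₂ violation
  ... | no none = inj₁ λ S S⊆X → ≮⇒≥ (λ violated → none (S , S⊆X , violated))

  feasible? : ∀ A → Dec (Feasible A)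
  feasible? A with feasibility A
  ... | inj₁ feasible = yes feasible
  ... | inj₂ (S , S⊆X , violated) = no (λ feasible → <⇒≱ violated (feasible S S⊆X))

  private
    tight-arith : ∀ u i s s' x → u + i ≡ s + s' → (s + 1) + (s' + 1) ≤ x + (i + 1) → u + 1 ≤ x
    tight-arith u i s s' x modular ≤x = +-cancelʳ-≤ (i + 1) (u + 1) x (begin
      (u + 1) + (i + 1)   ≡⟨ regroup u i ⟩
      (u + i) + 2         ≡⟨ cong (_+ 2) modular ⟩
      (s + s') + 2        ≡⟨ sym (regroup s s') ⟩
      (s + 1) + (s' + 1)  ≤⟨ ≤x ⟩
      x + (i + 1)         ∎)
      where
      open ≤-Reasoning
      regroup : ∀ a b → (a + 1) + (b + 1) ≡ (a + b) + 2
      regroup = solve-∀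

  -- For a feasible A ⊇ F, the union of two tight subsets of X is
  -- tight: ω is submodular, the weight modular, and edges kept for
  -- S ∩ S' are spanned by those kept for S or for S'.
  union-tight : ∀ {A S S'} → Feasible A → F ⊆ A → S ⊆ X → S' ⊆ X →
    Tight A S → Tight A S' → Tight A (S ∪ S')
  union-tight {A} {S} {S'} feasible F⊆A S⊆X S'⊆X S-tight S'-tight =
    tight-arith (weight (S ∪ S') h) (weight (S ∩ S') h) (weight S h) (weight S' h) (ω (A ∖[ S ∪ S' ]))
      (weight-modular S S' h) (begin
        (weight S h + 1) + (weight S' h + 1)
          ≤⟨ +-mono-≤ S-tight S'-tight ⟩
        ω (A ∖[ S ]) + ω (A ∖[ S' ])
          ≤⟨ ω-submodular (A ∖[ S ]) (A ∖[ S' ]) ⟩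
        ω ((A ∖[ S ]) ∩ (A ∖[ S' ])) + ω ((A ∖[ S ]) ∪ (A ∖[ S' ]))
          ≡⟨ cong (λ E → ω E + ω ((A ∖[ S ]) ∪ (A ∖[ S' ]))) (∖[]-∪ A S S') ⟩
        ω (A ∖[ S ∪ S' ]) + ω ((A ∖[ S ]) ∪ (A ∖[ S' ]))
          ≤⟨ +-monoʳ-≤ (ω (A ∖[ S ∪ S' ])) (ω-antiʷ (replaceʷ (∖[]-∩-connected F⊆A S⊆X S'⊆X))) ⟩
        ω (A ∖[ S ∪ S' ]) + ω (A ∖[ S ∩ S' ])
          ≤⟨ +-monoʳ-≤ (ω (A ∖[ S ∪ S' ])) (feasible (S ∩ S') (λ x∈ → S⊆X (proj₁ (x∈p∩q⁻ S S' x∈)))) ⟩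
        ω (A ∖[ S ∪ S' ]) + (weight (S ∩ S') h + 1) ∎)
    where open ≤-Reasoning

  -- Why deleting an edge e ∈ extra A v makes a feasible A ⊇ F
  -- infeasible: e is a bridge of A ∖[ S ] for a tight S ⊆ X avoiding v,
  -- and the ends of e are not both in X.
  record Obstruction (A : EdgeSet G) (v : Vertex) (e : Fin (m G)) : Set where
    field
      S : VSet G
      S⊆X : S ⊆ X
      tight : Tight A S
      v∉S : v ∉ S
      bridge : IsBridge (A ∖[ S ]) e
      ends⊈X : ¬ (end₁ e ∈ X × end₂ e ∈ X)

  obstruction : ∀ {A v e} → Feasible A → F ⊆ A → e ∈ extra A v → Violation (A - e) → Obstruction A v e
  obstruction {A} {v} {e} feasible F⊆A e∈extra (S , S⊆X , violated)
    with ∈-extra⁻ e∈extra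
       | bound-broken (feasible S S⊆X) (<-≤-trans violated (ω-anti ∖[]-e⊆))
    where
    ∖[]-e⊆ : (A ∖[ S ]) - e ⊆ (A - e) ∖[ S ]
    ∖[]-e⊆ f∈ with ∈-∖[]⁻ (p─q⊆p _ ⁅ e ⁆ f∈)
    ... | f∈A , kept = ∈-∖[]⁺ (x∈p∧x≢y⇒x∈p-y f∈A (x∈p-y⇒x≢y _ e f∈)) kept
  ... | _ , at-v , e∉F | e∈A∖[S] , bridge , tight = record
    { S = S ; S⊆X = S⊆X ; tight = tight ; v∉S = end∉S at-v ; bridge = bridge ; ends⊈X = ends⊈X }
    where
    ends∉S : end₁ e ∉ S × end₂ e ∉ S
    ends∉S with proj₂ (∈-∖[]⁻ e∈A∖[S])
    ... | inj₁ e∈F = ⊥-elim (e∉F e∈F)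
    ... | inj₂ ends∉S = ends∉S
    end∉S : ∀ {x} → end₁ e ≡ x ⊎ end₂ e ≡ x → x ∉ S
    end∉S (inj₁ refl) = proj₁ ends∉S
    end∉S (inj₂ refl) = proj₂ ends∉S
    ends⊈X : ¬ (end₁ e ∈ X × end₂ e ∈ X)
    ends⊈X (end₁∈X , end₂∈X) = bridge (liftʷ F⊆ (X-F e end₁∈X end₂∈X))
      where
      F⊆ : F ⊆ (A ∖[ S ]) - e
      F⊆ f∈F = x∈p∧x≢y⇒x∈p-y (∈-∖[]⁺ (F⊆A f∈F) (inj₁ f∈F)) (λ { refl → e∉F f∈F })

  record Barrier (A : EdgeSet G) (v : Vertex) (Q : EdgeSet G) : Set where
    field
      S : VSet G
      S⊆X : S ⊆ X
      tight : Tight A S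
      v∉S : v ∉ S
      bridges : ∀ {e} → e ∈ Q → IsBridge (A ∖[ S ]) e

  barrier : ∀ {A v} → Feasible A → F ⊆ A → ∀ Q → (∀ {e} → e ∈ Q → Obstruction A v e) → Barrier A v Q
  barrier {A} {v} feasible F⊆A = subset-induction P empty-barrier extend
    where
    P : EdgeSet G → Set
    P Q = (∀ {e} → e ∈ Q → Obstruction A v e) → Barrier A v Q
    empty-barrier : P ⊥
    empty-barrier _ = record
      { S = ⊥ ; S⊆X = λ x∈ → ⊥-elim (∉⊥ x∈) ; v∉S = ∉⊥ ; bridges = λ e∈ → ⊥-elim (∉⊥ e∈)
      ; tight = subst (λ w → w + 1 ≤ ω (A ∖[ ⊥ ])) (sym (weight-⊥ h)) (ω≥1 v) }
    extend : ∀ {Q e} → e ∈ Q → P (Q - e) → P Q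
    extend {Q} {e} e∈Q barrier-Q-e obstructed = record
      { S = S₁ ∪ S₂
      ; S⊆X = λ x∈ → [ O.S⊆X , B.S⊆X ] (x∈p∪q⁻ S₁ S₂ x∈)
      ; tight = union-tight feasible F⊆A O.S⊆X B.S⊆X O.tight B.tight
      ; v∉S = λ v∈ → [ O.v∉S , B.v∉S ] (x∈p∪q⁻ S₁ S₂ v∈)
      ; bridges = bridges }
      where
      module O = Obstruction (obstructed e∈Q)
      module B = Barrier (barrier-Q-e (λ f∈ → obstructed (p─q⊆p Q ⁅ e ⁆ f∈)))
      S₁ S₂ : VSet G
      S₁ = O.S
      S₂ = B.S
      bridges : ∀ {f} → f ∈ Q → IsBridge (A ∖[ S₁ ∪ S₂ ]) f
      bridges {f} f∈Q with f ≟ e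
      ... | yes refl = bridge-anti (∖[]-anti (p⊆p∪q S₂)) O.bridge
      ... | no f≢e = bridge-anti (∖[]-anti (q⊆p∪q S₁ S₂)) (B.bridges (x∈p∧x≢y⇒x∈p-y f∈Q f≢e))

  private
    cancel-tight : ∀ a b c d → a + 1 ≤ b → b + c ≤ (a + d) + 1 → c ≤ d
    cancel-tight a b c d a+1≤b ≤a+d+1 = +-cancelˡ-≤ (a + 1) c d (begin
      (a + 1) + c   ≤⟨ +-monoˡ-≤ c a+1≤b ⟩
      b + c         ≤⟨ ≤a+d+1 ⟩
      (a + d) + 1   ≡⟨ regroup a d ⟩
      (a + 1) + d   ∎)
      where
      open ≤-Reasoning
      regroup : ∀ a d → (a + d) + 1 ≡ (a + 1) + d
      regroup = solve-∀

  -- With S a barrier for extra A v,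
  -- all these edges are bridges of A ∖[ S ], and deleting them leaves
  -- A ∖[ S ∪ {v} ]; so by feasibility and tightness
  --   h(S) + 1 + ∣extra A v∣ ≤ ω (A ∖[ S ∪ {v} ]) ≤ h(S) + h(v) + 1.
  obstructed-bound : ∀ {A v} → Feasible A → F ⊆ A → v ∈ X →
    (∀ {e} → e ∈ extra A v → Obstruction A v e) → ∣ extra A v ∣ ≤ h v
  obstructed-bound {A} {v} feasible F⊆A v∈X obstructed =
    cancel-tight (weight S h) (ω (A ∖[ S ])) ∣ extra A v ∣ (h v) tight (begin
      ω (A ∖[ S ]) + ∣ extra A v ∣      ≤⟨ ω-remove-bridges (A ∖[ S ]) (extra A v) extra⊆ bridges ⟩
      ω ((A ∖[ S ]) ─ extra A v)        ≤⟨ ω-anti ⊆rest ⟩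
      ω (A ∖[ S ∪ ⁅ v ⁆ ])              ≤⟨ feasible (S ∪ ⁅ v ⁆) S∪v⊆X ⟩
      weight (S ∪ ⁅ v ⁆) h + 1          ≤⟨ +-monoˡ-≤ 1 (weight-∪⁅⁆ S v h) ⟩
      (weight S h + h v) + 1            ∎)
    where
    open ≤-Reasoning
    open Barrier (barrier feasible F⊆A (extra A v) obstructed)
    S∪v⊆X : S ∪ ⁅ v ⁆ ⊆ X
    S∪v⊆X x∈ with x∈p∪q⁻ S ⁅ v ⁆ x∈
    ... | inj₁ x∈S = S⊆X x∈S
    ... | inj₂ x∈⁅v⁆ rewrite x∈⁅y⁆⇒x≡y v x∈⁅v⁆ = v∈X
    -- One end of an extra edge is v ∉ S; the other is not in S either,
    -- for then both ends would lie in X.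
    extra⊆ : extra A v ⊆ A ∖[ S ]
    extra⊆ {e} e∈ with ∈-extra⁻ e∈
    ... | e∈A , at-v , _ = ∈-∖[]⁺ e∈A (inj₂ (ends∉S at-v))
      where
      ends⊈X : ¬ (end₁ e ∈ X × end₂ e ∈ X)
      ends⊈X = Obstruction.ends⊈X (obstructed e∈)
      ends∉S : end₁ e ≡ v ⊎ end₂ e ≡ v → end₁ e ∉ S × end₂ e ∉ S
      ends∉S (inj₁ refl) = v∉S , λ end₂∈S → ends⊈X (v∈X , S⊆X end₂∈S)
      ends∉S (inj₂ refl) = (λ end₁∈S → ends⊈X (S⊆X end₁∈S , v∈X)) , v∉S
    ⊆rest : A ∖[ S ∪ ⁅ v ⁆ ] ⊆ (A ∖[ S ]) ─ extra A v
    ⊆rest {f} f∈ = x∈p∧x∉q⇒x∈p─q (∖[]-anti (p⊆p∪q ⁅ v ⁆) f∈) not-extra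
      where
      not-extra : f ∉ extra A v
      not-extra f∈extra with ∈-extra⁻ f∈extra | proj₂ (∈-∖[]⁻ f∈)
      ... | _ , _ , f∉F | inj₁ f∈F = f∉F f∈F
      ... | _ , inj₁ refl , _ | inj₂ (v∉ , _) = v∉ (x∈p∪q⁺ (inj₂ (x∈⁅x⁆ v)))
      ... | _ , inj₂ refl , _ | inj₂ (_ , v∉) = v∉ (x∈p∪q⁺ (inj₂ (x∈⁅x⁆ v)))

  deletable : ∀ {A v} → Feasible A → F ⊆ A → v ∈ X → h v < ∣ extra A v ∣ →
    Σ (Fin (m G)) λ e → e ∈ extra A v × Feasible (A - e)
  deletable {A} {v} feasible F⊆A v∈X excess with any? (λ e → (e ∈? extra A v) ×-dec feasible? (A - e))
  ... | yes found = found
  ... | no none = ⊥-elim (<⇒≱ excess (obstructed-bound feasible F⊆A v∈X obstructed))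
    where
    obstructed : ∀ {e} → e ∈ extra A v → Obstruction A v e
    obstructed {e} e∈ with feasibility (A - e)
    ... | inj₁ still-feasible = ⊥-elim (none (e , e∈ , still-feasible))
    ... | inj₂ violation = obstruction feasible F⊆A e∈ violation

  DegreeBoundedTree : EdgeSet G → Set
  DegreeBoundedTree T = F ⊆ T × IsSpanningTree G T × (∀ v → v ∈ X → deg G T v ≤ h v + deg G F v)

  deg-⊇F : ∀ {T} → F ⊆ T → ∀ v → deg G T v ≡ deg G F v + ∣ (T ∩ incident G v) ─ F ∣
  deg-⊇F {T} F⊆T v = begin
    deg G T v                                                ≡⟨ deg≡∣∩incident∣ T v ⟩
    ∣ T ∩ I ∣                                                ≡⟨ ∣p∣≡∣p∩q∣+∣p─q∣ (T ∩ I) F ⟩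
    ∣ (T ∩ I) ∩ F ∣ + ∣ (T ∩ I) ─ F ∣                        ≡⟨ cong (λ E → ∣ E ∣ + ∣ (T ∩ I) ─ F ∣) forest-part ⟩
    ∣ F ∩ I ∣ + ∣ (T ∩ I) ─ F ∣                              ≡⟨ cong (_+ ∣ (T ∩ I) ─ F ∣) (sym (deg≡∣∩incident∣ F v)) ⟩
    deg G F v + ∣ (T ∩ I) ─ F ∣                              ∎
    where
    open ≡-Reasoning
    I : EdgeSet G
    I = incident G v
    forest-part : (T ∩ I) ∩ F ≡ F ∩ I
    forest-part = ⊆-antisym
      (λ f∈ → let (f∈TI , f∈F) = x∈p∩q⁻ (T ∩ I) F f∈ in x∈p∩q⁺ (f∈F , proj₂ (x∈p∩q⁻ T I f∈TI)))
      (λ f∈ → let (f∈F , f∈I) = x∈p∩q⁻ F I f∈ in x∈p∩q⁺ (x∈p∩q⁺ (F⊆T f∈F , f∈I) , f∈F))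

  -- If A ⊇ F is feasible and no vertex of X has excess, any spanning
  -- forest of A through F is a tree as required: feasibility for S = ⊥
  -- makes A connected, and the extra edges of T at v are extra edges of A.
  tree-without-excess : ∀ {A} → Feasible A → F ⊆ A → (∀ v → v ∈ X → ∣ extra A v ∣ ≤ h v) →
    Σ (EdgeSet G) DegreeBoundedTree
  tree-without-excess {A} feasible F⊆A no-excess with spanning-forest F⊆A F-forest
  ... | T , F⊆T , T⊆A , T-forest , covers =
    T , F⊆T , (T-forest , λ u v → replaceʷ covers (ω≤1⇒connected A-connected u v)) , bounded
    where
    A-connected : ω A ≤ 1
    A-connected = begin
      ω A                   ≤⟨ ω-anti (λ f∈ → proj₁ (∈-∖[]⁻ f∈)) ⟩
      ω (A ∖[ ⊥ ])          ≤⟨ feasible ⊥ (λ x∈ → ⊥-elim (∉⊥ x∈)) ⟩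
      weight ⊥ h + 1        ≡⟨ cong (_+ 1) (weight-⊥ h) ⟩
      1                     ∎
      where open ≤-Reasoning
    bounded : ∀ v → v ∈ X → deg G T v ≤ h v + deg G F v
    bounded v v∈X = begin
      deg G T v                                    ≡⟨ deg-⊇F F⊆T v ⟩
      deg G F v + ∣ (T ∩ incident G v) ─ F ∣       ≤⟨ +-monoʳ-≤ (deg G F v) (p⊆q⇒∣p∣≤∣q∣ extra-T⊆extra-A) ⟩
      deg G F v + ∣ extra A v ∣                    ≤⟨ +-monoʳ-≤ (deg G F v) (no-excess v v∈X) ⟩
      deg G F v + h v                              ≡⟨ +-comm (deg G F v) (h v) ⟩
      h v + deg G F v                              ∎
      where
      open ≤-Reasoning
      extra-T⊆extra-A : (T ∩ incident G v) ─ F ⊆ extra A v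
      extra-T⊆extra-A f∈ with x∈p∩q⁻ T (incident G v) (p─q⊆p _ F f∈)
      ... | f∈T , f∈I = x∈p∧x∉q⇒x∈p─q (x∈p∩q⁺ (T⊆A f∈T , f∈I)) (x∈p─q⇒x∉q _ F f∈)

  -- Sufficiency: deleting deletable edges one at a time (A shrinks, so
  -- this ends) leaves a feasible A ⊇ F without excess.
  tree-in : ∀ A → Feasible A → F ⊆ A → Σ (EdgeSet G) DegreeBoundedTree
  tree-in A = go A (⊂-wellFounded A)
    where
    go : ∀ A → Acc _⊂_ A → Feasible A → F ⊆ A → Σ (EdgeSet G) DegreeBoundedTree
    go A (acc smaller) feasible F⊆A with any? (λ v → (v ∈? X) ×-dec (h v <? ∣ extra A v ∣))
    ... | no none = tree-without-excess feasible F⊆A λ v v∈X → ≮⇒≥ (λ excess → none (v , v∈X , excess))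
    ... | yes (v , v∈X , excess) with deletable feasible F⊆A v∈X excess
    ...   | e , e∈extra , feasible-without-e with ∈-extra⁻ e∈extra
    ...     | e∈A , _ , e∉F = go (A - e) (smaller (x∈p⇒p-x⊂p e∈A)) feasible-without-e
                                (λ f∈F → x∈p∧x≢y⇒x∈p-y (F⊆A f∈F) (λ { refl → e∉F f∈F }))

  -- In a tree T as required, the edges of T deleted in
  -- T ∖[ S ] are extra edges of T at vertices of S, at most h(S) of
  -- them; deleting them from the connected T leaves at most h(S) + 1
  -- components, and G ∖ [S, F] ⊇ T ∖[ S ] has no more.
  deleted-bound : ∀ {T} → DegreeBoundedTree T → ∀ S → S ⊆ X → ∣ T ─ (T ∖[ S ]) ∣ ≤ weight S h
  deleted-bound {T} (F⊆T , _ , bounded) S S⊆X = begin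
    ∣ T ─ (T ∖[ S ]) ∣                        ≤⟨ p⊆q⇒∣p∣≤∣q∣ deleted⊆ ⟩
    ∣ ⋃ (map at (allFin (n G))) ∣             ≤⟨ ∣⋃ps∣≤sum (map at (allFin (n G))) ⟩
    sum (map ∣_∣ (map at (allFin (n G))))     ≡⟨ cong sum (sym (map-∘ (allFin (n G)))) ⟩
    sum (map (∣_∣ ∘ at) (allFin (n G)))       ≤⟨ sum-map-mono (allFin (n G)) ∣at∣≤ ⟩
    weight S h                                ∎
    where
    open ≤-Reasoning
    at : Vertex → EdgeSet G
    at v = if lookup S v then (T ∩ incident G v) ─ F else ⊥
    ∣at∣≤ : ∀ v → ∣ at v ∣ ≤ (if lookup S v then h v else 0)
    ∣at∣≤ v with lookup S v in v∈S
    ... | false = ≤-reflexive (∣⊥∣≡0 (m G))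
    ... | true = +-cancelˡ-≤ (deg G F v) _ _ (begin
      deg G F v + ∣ (T ∩ incident G v) ─ F ∣   ≡⟨ sym (deg-⊇F F⊆T v) ⟩
      deg G T v                                ≤⟨ bounded v (S⊆X (lookup⇒[]= v S v∈S)) ⟩
      h v + deg G F v                          ≡⟨ +-comm (h v) (deg G F v) ⟩
      deg G F v + h v                          ∎)
    in-at : ∀ {f x} → f ∈ T → f ∉ F → x ∈ S → end₁ f ≡ x ⊎ end₂ f ≡ x → f ∈ ⋃ (map at (allFin (n G)))
    in-at {f} {x} f∈T f∉F x∈S at-x = x∈⋃⁺ f∈at (∈-map⁺ at (∈-allFin x))
      where
      f∈at : f ∈ at x
      f∈at rewrite []=⇒lookup x∈S = x∈p∧x∉q⇒x∈p─q (x∈p∩q⁺ (f∈T , ∈-incident⁺ at-x)) f∉F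
    deleted⊆ : T ─ (T ∖[ S ]) ⊆ ⋃ (map at (allFin (n G)))
    deleted⊆ {f} f∈ with p─q⊆p T _ f∈ | x∈p─q⇒x∉q T _ f∈
    ... | f∈T | f∉T∖[S] with f ∈? F | end₁ f ∈? S | end₂ f ∈? S
    ...   | yes f∈F | _ | _ = ⊥-elim (f∉T∖[S] (∈-∖[]⁺ f∈T (inj₁ f∈F)))
    ...   | no f∉F | yes end₁∈S | _ = in-at f∈T f∉F end₁∈S (inj₁ refl)
    ...   | no f∉F | no _ | yes end₂∈S = in-at f∈T f∉F end₂∈S (inj₂ refl)
    ...   | no _ | no end₁∉S | no end₂∉S = ⊥-elim (f∉T∖[S] (∈-∖[]⁺ f∈T (inj₂ (end₁∉S , end₂∉S))))

  necessary : ∀ {T} → DegreeBoundedTree T → ∀ S → S ⊆ X → ω (removeExcept G S F) ≤ weight S h + 1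
  necessary {T} tree@(_ , (_ , T-connected) , _) S S⊆X = begin
    ω (removeExcept G S F)                              ≤⟨ ω-anti (λ f∈ → ∈-removeExcept⁺ (proj₂ (∈-∖[]⁻ f∈))) ⟩
    ω (T ∖[ S ])                                        ≤⟨ ω-union-bound (T ∖[ S ]) (T ─ (T ∖[ S ])) ⟩
    ω ((T ∖[ S ]) ∪ (T ─ (T ∖[ S ]))) + ∣ T ─ (T ∖[ S ]) ∣
                                                        ≤⟨ +-mono-≤ (≤-trans (ω-anti T⊆) (connected⇒ω≤1 T-connected))
                                                                    (deleted-bound tree S S⊆X) ⟩
    1 + weight S h                                      ≡⟨ +-comm 1 (weight S h) ⟩
    weight S h + 1                                      ∎
    where
    open ≤-Reasoning
    T⊆ : T ⊆ (T ∖[ S ]) ∪ (T ─ (T ∖[ S ]))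
    T⊆ {f} f∈T with f ∈? T ∖[ S ]
    ... | yes kept = x∈p∪q⁺ (inj₁ kept)
    ... | no deleted = x∈p∪q⁺ (inj₂ (x∈p∧x∉q⇒x∈p─q f∈T deleted))

  all∖[]≡removeExcept : ∀ S → ⊤ ∖[ S ] ≡ removeExcept G S F
  all∖[]≡removeExcept S = ⊆-antisym (λ f∈ → ∈-removeExcept⁺ (proj₂ (∈-∖[]⁻ f∈)))
                                    (λ f∈ → ∈-∖[]⁺ ∈⊤ (∈-removeExcept⁻ f∈))

theorem3p5 : (G : Graph) (F : EdgeSet G) → IsForest G F →
    (X : VSet G) → eZero G X F → (h : Fin (n G) → ℕ) →
    (Σ (EdgeSet G) λ T → SubE G F T × IsSpanningTree G T ×
        (∀ v → v ∈ X → deg G T v ≤ h v + deg G F v))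
    ⇔ (∀ (S : VSet G) → SubV G S X → ∀ k → HasComponents G (removeExcept G S F) k →
        k ≤ sumOver G S h + 1)
theorem3p5 G F F-forest X X-F h = mk⇔
  (λ { (T , tree) S S⊆X k components →
         subst (_≤ weight S h + 1) (sym (ω-unique components)) (necessary tree S S⊆X) })
  (λ condition → tree-in ⊤ (everything-feasible condition) (λ _ → ∈⊤))
  where
  open Components G
  open Setting G F F-forest X X-F h
  everything-feasible : (∀ S → S ⊆ X → ∀ k → HasComponents G (removeExcept G S F) k → k ≤ weight S h + 1) →
    Feasible ⊤
  everything-feasible condition S S⊆X =
    subst (_≤ weight S h + 1) (cong ω (sym (all∖[]≡removeExcept S)))
      (condition S S⊆X _ (ω-components (removeExcept G S F)))
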